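{- Let $P$ and $Q$ be finite naturally labeled posets with ordinal sum decompositions into irreducible posets $P=P_1\oplus P_2\oplus\cdots\oplus P_k$ and $Q=Q_1\oplus Q_2\oplus\cdots\oplus Q_j$. If $K_P(\mathbf{x})=K_Q(\mathbf{x})$, then $k=j$ and $K_{P_i}(\mathbf{x})=K_{Q_i}(\mathbf{x})$ for $i=1,\dots,k$.
   Context: A poset $(P,\preceq)$ on ground set $[n]$ is naturally labeled if $x\preceq y$ implies $x\le y$ as integers; subposets inherit a natural labeling (relabel order-preservingly). For such $P$, $K_P(\mathbf{x})=\sum_{\sigma}\prod_{p\in P}x_{\sigma(p)}$, the sum over all maps $\sigma:P\to\mathbb{Z}^+$ with $\sigma(x)\le\sigma(y)$ whenever $x\preceq y$ (this depends only on the isomorphism class of the poset). The ordinal sum $Q\oplus R$ is the poset on $Q\sqcup R$ where $x\preceq y$ iff $x\preceq_Q y$, or $x\preceq_R y$, or $x\in Q$ and $y\in R$. A finite poset is irreducible if $P=Q\oplus R$ implies $Q=\varnothing$ or $R=\varnothing$; every finite poset has a unique decomposition as an ordinal sum of nonempty irreducible posets. -}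

module Defs where

open import Data.Nat using (ℕ; zero; suc; _+_; _≤_; _≤ᵇ_; _≡ᵇ_)
open import Data.Fin using (Fin; toℕ; splitAt)
open import Data.Bool using (Bool; true; false; T; _∧_; _∨_; not; if_then_else_)
open import Data.List using (List; []; _∷_; length; map; concatMap; filter; allFin; foldr)
open import Data.List.Relation.Unary.All using (All)
open import Data.Vec using (Vec; lookup)
open import Data.Sum using (_⊎_; inj₁; inj₂)
open import Relation.Binary.PropositionalEquality using (_≡_)

record RawPoset : Set where
  field
    size : ℕ
    le   : Fin size → Fin size → Bool
open RawPoset public

record IsNLPoset (P : RawPoset) : Set where
  field
    refl≼    : ∀ x → T (le P x x)
    antisym≼ : ∀ x y → T (le P x y) → T (le P y x) → x ≡ y
    trans≼   : ∀ x y z → T (le P x y) → T (le P y z) → T (le P x z)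
    natural  : ∀ x y → T (le P x y) → toℕ x ≤ toℕ y
open IsNLPoset public

-- Ordinal sum Q ⊕ R on [a + b]: Q occupies labels 1..a, R the labels a+1..a+b
-- (this is a naturally labeled poset whenever Q and R are).
_⊕_ : RawPoset → RawPoset → RawPoset
Q ⊕ R = record { size = size Q + size R ; le = rel }
  where
  rel : Fin (size Q + size R) → Fin (size Q + size R) → Bool
  rel x y with splitAt (size Q) x | splitAt (size Q) y
  ... | inj₁ i | inj₁ j = le Q i j
  ... | inj₂ i | inj₂ j = le R i j
  ... | inj₁ _ | inj₂ _ = true
  ... | inj₂ _ | inj₁ _ = false

∅P : RawPoset
∅P = record { size = 0 ; le = λ () }

⨁ : List RawPoset → RawPoset
⨁ []       = ∅P
⨁ (P ∷ Ps) = P ⊕ ⨁ Ps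

record _≅_ (P Q : RawPoset) : Set where
  field
    to      : Fin (size P) → Fin (size Q)
    from    : Fin (size Q) → Fin (size P)
    from∘to : ∀ x → from (to x) ≡ x
    to∘from : ∀ y → to (from y) ≡ y
    pres    : ∀ x y → le P x y ≡ le Q (to x) (to y)

Irreducible : RawPoset → Set
Irreducible P = ∀ Q R → IsNLPoset Q → IsNLPoset R → P ≅ (Q ⊕ R) →
                size Q ≡ 0 ⊎ size R ≡ 0

-- The coefficient of the monomial x₁^α₁ ⋯ x_m^α_m in K_P(x) is the number
-- of maps σ : P → {1,…,m} (⊆ ℤ⁺) with σ(x) ≤ σ(y) whenever x ≼ y and
-- |σ⁻¹(i)| = αᵢ for every i.

allFuns : (n m : ℕ) → List (Fin n → Fin m)
allFuns zero    m = (λ ()) ∷ []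
allFuns (suc n) m =
  concatMap (λ f → map (λ v → cons v f) (allFin m)) (allFuns n m)
  where
  cons : Fin m → (Fin n → Fin m) → Fin (suc n) → Fin m
  cons v f Fin.zero    = v
  cons v f (Fin.suc i) = f i

allB : {A : Set} → (A → Bool) → List A → Bool
allB p = foldr (λ a b → p a ∧ b) true

countB : {A : Set} → (A → Bool) → List A → ℕ
countB p = foldr (λ a c → if p a then suc c else c) 0

_≟Fᵇ_ : {m : ℕ} → Fin m → Fin m → Bool
i ≟Fᵇ j = toℕ i ≡ᵇ toℕ j

orderPreservingᵇ : (P : RawPoset) {m : ℕ} → (Fin (size P) → Fin m) → Bool
orderPreservingᵇ P σ =
  allB (λ x → allB (λ y → not (le P x y) ∨ (toℕ (σ x) ≤ᵇ toℕ (σ y)))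
                   (allFin (size P)))
       (allFin (size P))

hasContentᵇ : (P : RawPoset) {m : ℕ} → Vec ℕ m → (Fin (size P) → Fin m) → Bool
hasContentᵇ P {m} α σ =
  allB (λ i → countB (λ x → σ x ≟Fᵇ i) (allFin (size P)) ≡ᵇ lookup α i)
       (allFin m)

coeffK : (P : RawPoset) {m : ℕ} → Vec ℕ m → ℕ
coeffK P {m} α =
  countB (λ σ → orderPreservingᵇ P σ ∧ hasContentᵇ P α σ) (allFuns (size P) m)

SameK : RawPoset → RawPoset → Set
SameK P Q = ∀ (m : ℕ) (α : Vec ℕ m) → coeffK P α ≡ coeffK Q α

IrredDecomp : RawPoset → List RawPoset → Set
IrredDecomp P Ps =
  All (λ Pi → IsNLPoset Pi) Ps × All (λ Pi → 1 ≤ size Pi) Ps ×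
  All Irreducible Ps × (P ≅ ⨁ Ps)
  where open import Data.Product using (_×_)

module Submission where

-- Three facts about these coefficients carry the proof.
--  * Peeling: adding |B| to the last entry of α forces the top value on all
--    of B, so  coeffK A β = coeffK (A ⊕ B) (β + |B|·e_top); dually
--    coeffK B γ = coeffK (A ⊕ B) (γ + |A|·e_bottom).
--  * Cut counting: coeffK P (t , |P| - t) counts the down-sets of size t.
--    In A ⊕ B the only down-set of size |A| is A, so the count is 1; in a
--    naturally labeled irreducible Q with 0 < t < |Q| the labels < t are not
--    a cut, and exchanging one element yields a second down-set.
--  * K_P determines |P| and is invariant under isomorphism.
-- If K_{P₁ ⊕ R} = K_{Q₁ ⊕ R'} with P₁, Q₁ irreducible, cut counting at
-- t = min(|P₁|, |Q₁|) forces |P₁| = |Q₁|, peeling gives K_{P₁} = K_{Q₁} and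
-- K_R = K_{R'}, and induction along the decompositions proves the theorem.

open import Defs
open import Data.Nat using (ℕ; zero; suc; _+_; _*_; _∸_; _≤_; _<_; _<ᵇ_; z≤n; s≤s; s≤s⁻¹; _≤?_; _<?_)
open import Data.Nat.Properties hiding (suc-injective)
open import Data.Fin using (Fin; toℕ; splitAt; _↑ˡ_; _↑ʳ_; cast; fromℕ)
import Data.Fin as F
open import Data.Fin.Properties
  using (toℕ-injective; toℕ<n; toℕ-fromℕ; splitAt-↑ˡ; splitAt-↑ʳ;
         splitAt⁻¹-↑ˡ; splitAt⁻¹-↑ʳ; toℕ-cast; toℕ-↑ˡ; toℕ-↑ʳ; any?; suc-injective)
open import Data.Bool using (Bool; true; false; T; _∧_; _∨_; not; if_then_else_)
import Data.Bool.Properties as Bool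
open import Data.List using (List; []; _∷_; length; map; concatMap; concat; allFin; foldr; tabulate; _++_)
open import Data.List.Relation.Unary.All using (All; []; _∷_)
open import Data.List.Relation.Binary.Pointwise using (Pointwise; []; _∷_)
open import Data.Vec using (Vec; lookup; []; _∷_)
open import Data.Product using (_×_; _,_; proj₁; proj₂; Σ)
open import Data.Sum using (_⊎_; inj₁; inj₂; [_,_]′)
open import Data.Unit using (tt)
open import Data.Empty using (⊥; ⊥-elim)
open import Relation.Nullary using (¬_; Dec; yes; no)
open import Relation.Nullary.Decidable using (_×-dec_)
open import Relation.Binary.PropositionalEquality
open import Relation.Binary.Definitions using (tri<; tri≈; tri>)
open import Function using (_∘_; id)
open import Function.Bundles using (Equivalence)
open import Algebra.Properties.CommutativeSemigroup +-commutativeSemigroup using (interchange)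

⟦_⟧ : Bool → ℕ
⟦ true ⟧  = 1
⟦ false ⟧ = 0

⟦⟧≤1 : (b : Bool) → ⟦ b ⟧ ≤ 1
⟦⟧≤1 true  = s≤s z≤n
⟦⟧≤1 false = z≤n

sumL : {A : Set} → (A → ℕ) → List A → ℕ
sumL h = foldr (λ a s → h a + s) 0

sumFin : {n : ℕ} → (Fin n → ℕ) → ℕ
sumFin {zero}  g = 0
sumFin {suc n} g = g F.zero + sumFin (g ∘ F.suc)

countB-sumL : {A : Set} (p : A → Bool) (xs : List A) → countB p xs ≡ sumL (⟦_⟧ ∘ p) xs
countB-sumL p [] = refl
countB-sumL p (x ∷ xs) with p x
... | true  = cong suc (countB-sumL p xs)
... | false = countB-sumL p xs

sumL-cong : {A : Set} {h h' : A → ℕ} (xs : List A) → (∀ a → h a ≡ h' a) → sumL h xs ≡ sumL h' xs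
sumL-cong []       e = refl
sumL-cong (x ∷ xs) e = cong₂ _+_ (e x) (sumL-cong xs e)

sumL-mono : {A : Set} {h h' : A → ℕ} (xs : List A) → (∀ a → h a ≤ h' a) → sumL h xs ≤ sumL h' xs
sumL-mono []       e = z≤n
sumL-mono (x ∷ xs) e = +-mono-≤ (e x) (sumL-mono xs e)

sumL-zero : {A : Set} (xs : List A) → sumL (λ _ → 0) xs ≡ 0
sumL-zero []       = refl
sumL-zero (_ ∷ xs) = sumL-zero xs

sumL-+ : {A : Set} (h k : A → ℕ) (xs : List A) → sumL (λ a → h a + k a) xs ≡ sumL h xs + sumL k xs
sumL-+ h k [] = refl
sumL-+ h k (x ∷ xs) = begin
  h x + k x + sumL (λ a → h a + k a) xs ≡⟨ cong (h x + k x +_) (sumL-+ h k xs) ⟩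
  h x + k x + (sumL h xs + sumL k xs)   ≡⟨ interchange (h x) (k x) (sumL h xs) (sumL k xs) ⟩
  h x + sumL h xs + (k x + sumL k xs)   ∎
  where open ≡-Reasoning

sumL-++ : {A : Set} (h : A → ℕ) (xs ys : List A) → sumL h (xs ++ ys) ≡ sumL h xs + sumL h ys
sumL-++ h []       ys = refl
sumL-++ h (x ∷ xs) ys = trans (cong (h x +_) (sumL-++ h xs ys)) (sym (+-assoc (h x) _ _))

sumL-map : {A B : Set} (h : B → ℕ) (g : A → B) (xs : List A) → sumL h (map g xs) ≡ sumL (h ∘ g) xs
sumL-map h g []       = refl
sumL-map h g (x ∷ xs) = cong (h (g x) +_) (sumL-map h g xs)

sumL-concatMap : {A B : Set} (h : B → ℕ) (g : A → List B) (xs : List A) →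
                 sumL h (concatMap g xs) ≡ sumL (λ a → sumL h (g a)) xs
sumL-concatMap h g []       = refl
sumL-concatMap h g (x ∷ xs) =
  trans (sumL-++ h (g x) (concat (map g xs))) (cong (sumL h (g x) +_) (sumL-concatMap h g xs))

sumL-swap : {A B : Set} (H : A → B → ℕ) (xs : List A) (ys : List B) →
            sumL (λ a → sumL (H a) ys) xs ≡ sumL (λ b → sumL (λ a → H a b) xs) ys
sumL-swap H []       ys = sym (sumL-zero ys)
sumL-swap H (x ∷ xs) ys =
  trans (cong (sumL (H x) ys +_) (sumL-swap H xs ys))
        (sym (sumL-+ (H x) (λ b → sumL (λ a → H a b) xs) ys))

-- allFin n = tabulate id, so list sums over allFin are sums over Fin n.
sumL-tabulate : {A : Set} {n : ℕ} (h : A → ℕ) (f : Fin n → A) → sumL h (tabulate f) ≡ sumFin (h ∘ f)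
sumL-tabulate {n = zero}  h f = refl
sumL-tabulate {n = suc n} h f = cong (h (f F.zero) +_) (sumL-tabulate h (f ∘ F.suc))

sumFin-cong : {n : ℕ} {g g' : Fin n → ℕ} → (∀ i → g i ≡ g' i) → sumFin g ≡ sumFin g'
sumFin-cong {zero}  e = refl
sumFin-cong {suc n} e = cong₂ _+_ (e F.zero) (sumFin-cong (e ∘ F.suc))

sumFin-const : (n c : ℕ) → sumFin {n} (λ _ → c) ≡ n * c
sumFin-const zero    c = refl
sumFin-const (suc n) c = cong (c +_) (sumFin-const n c)

sumFin-zero : (n : ℕ) → sumFin {n} (λ _ → 0) ≡ 0
sumFin-zero n = trans (sumFin-const n 0) (*-zeroʳ n)

sumFin-+ : {n : ℕ} (g h : Fin n → ℕ) → sumFin (λ v → g v + h v) ≡ sumFin g + sumFin h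
sumFin-+ {zero}  g h = refl
sumFin-+ {suc n} g h =
  trans (cong (g F.zero + h F.zero +_) (sumFin-+ (g ∘ F.suc) (h ∘ F.suc)))
        (interchange (g F.zero) (h F.zero) (sumFin (g ∘ F.suc)) (sumFin (h ∘ F.suc)))

sumFin-split : (a b : ℕ) (g : Fin (a + b) → ℕ) → sumFin g ≡ sumFin (g ∘ (_↑ˡ b)) + sumFin (g ∘ (a ↑ʳ_))
sumFin-split zero    b g = refl
sumFin-split (suc a) b g =
  trans (cong (g F.zero +_) (sumFin-split a b (g ∘ F.suc))) (sym (+-assoc (g F.zero) _ _))

sumFin-single : {n : ℕ} (g : Fin n → ℕ) (c : Fin n) → (∀ x → ¬ x ≡ c → g x ≡ 0) → sumFin g ≡ g c
sumFin-single {suc n} g F.zero z =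
  trans (cong (g F.zero +_) (trans (sumFin-cong (λ i → z (F.suc i) (λ ()))) (sumFin-zero n)))
        (+-identityʳ _)
sumFin-single {suc n} g (F.suc c) z =
  trans (cong (_+ sumFin (g ∘ F.suc)) (z F.zero (λ ())))
        (sumFin-single (g ∘ F.suc) c (λ x ne → z (F.suc x) (ne ∘ suc-injective)))

count : {n : ℕ} → (Fin n → Bool) → ℕ
count g = sumFin (⟦_⟧ ∘ g)

count-≤ : {n : ℕ} (g : Fin n → Bool) → count g ≤ n
count-≤ {zero}  g = z≤n
count-≤ {suc n} g = +-mono-≤ (⟦⟧≤1 (g F.zero)) (count-≤ (g ∘ F.suc))

count-< : {n : ℕ} (g : Fin n → Bool) (y : Fin n) → g y ≡ false → count g < n
count-< {suc n} g F.zero    e rewrite e = s≤s (count-≤ (g ∘ F.suc))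
count-< {suc n} g (F.suc y) e = +-mono-≤-< (⟦⟧≤1 (g F.zero)) (count-< (g ∘ F.suc) y e)

count-empty : {n : ℕ} (g : Fin n → Bool) → (∀ x → g x ≡ false) → count g ≡ 0
count-empty {n} g z = trans (sumFin-cong (λ x → cong ⟦_⟧ (z x))) (sumFin-zero n)

count-empty⁻¹ : {n : ℕ} (g : Fin n → Bool) → count g ≡ 0 → ∀ x → g x ≡ false
count-empty⁻¹ {suc n} g e F.zero with g F.zero | e
... | false | _ = refl
count-empty⁻¹ {suc n} g e (F.suc x) with g F.zero | e
... | false | e' = count-empty⁻¹ (g ∘ F.suc) e' x

count-complement : {n : ℕ} (s : Fin n → Bool) → count s + count (not ∘ s) ≡ n
count-complement {zero}  s = refl
count-complement {suc n} s with s F.zero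
... | true  = cong suc (count-complement (s ∘ F.suc))
... | false = trans (+-suc _ _) (cong suc (count-complement (s ∘ F.suc)))

count-initial : (n t : ℕ) → t ≤ n → count {n} (λ v → toℕ v <ᵇ t) ≡ t
count-initial zero    zero    _       = refl
count-initial (suc n) zero    _       = count-initial n zero z≤n
count-initial (suc n) (suc t) (s≤s l) = cong suc (count-initial n t l)

T-ext : {a b : Bool} → (T a → T b) → (T b → T a) → a ≡ b
T-ext {false} {false} f g = refl
T-ext {false} {true}  f g = ⊥-elim (g tt)
T-ext {true}  {false} f g = ⊥-elim (f tt)
T-ext {true}  {true}  f g = refl

T→true : {a : Bool} → T a → a ≡ true
T→true {true} _ = refl

¬T→false : {a : Bool} → ¬ T a → a ≡ false
¬T→false {false} _ = refl
¬T→false {true}  n = ⊥-elim (n tt)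

true→T : {a : Bool} → a ≡ true → T a
true→T refl = tt

≟Fᵇ→ : {m : ℕ} {i j : Fin m} → T (i ≟Fᵇ j) → i ≡ j
≟Fᵇ→ {i = i} {j} t = toℕ-injective (≡ᵇ⇒≡ (toℕ i) (toℕ j) t)

≟Fᵇ← : {m : ℕ} {i j : Fin m} → i ≡ j → T (i ≟Fᵇ j)
≟Fᵇ← {i = i} {j} e = ≡⇒≡ᵇ (toℕ i) (toℕ j) (cong toℕ e)

≟Fᵇ-refl : {m : ℕ} (i : Fin m) → (i ≟Fᵇ i) ≡ true
≟Fᵇ-refl i = T→true (≟Fᵇ← {i = i} refl)

≟Fᵇ-≢ : {m : ℕ} {i j : Fin m} → ¬ i ≡ j → (i ≟Fᵇ j) ≡ false
≟Fᵇ-≢ {i = i} {j} ne = ¬T→false (ne ∘ ≟Fᵇ→ {i = i} {j})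

count-point : {n : ℕ} (c : Fin n) → count (λ v → v ≟Fᵇ c) ≡ 1
count-point c = trans (sumFin-single _ c (λ x ne → cong ⟦_⟧ (≟Fᵇ-≢ ne))) (cong ⟦_⟧ (≟Fᵇ-refl c))

allB-tabulate→ : {A : Set} {n : ℕ} (p : A → Bool) (f : Fin n → A) →
                 T (allB p (tabulate f)) → ∀ i → T (p (f i))
allB-tabulate→ {n = suc n} p f t i with p (f F.zero) in e
allB-tabulate→ {n = suc n} p f t F.zero    | true = subst T (sym e) tt
allB-tabulate→ {n = suc n} p f t (F.suc i) | true = allB-tabulate→ p (f ∘ F.suc) t i

allB-tabulate← : {A : Set} {n : ℕ} (p : A → Bool) (f : Fin n → A) →
                 (∀ i → T (p (f i))) → T (allB p (tabulate f))
allB-tabulate← {n = zero}  p f h = tt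
allB-tabulate← {n = suc n} p f h with p (f F.zero) | h F.zero
... | true | _ = allB-tabulate← p (f ∘ F.suc) (h ∘ F.suc)

-- Pointwise Boolean equality of maps Fin n → Fin m (kept opaque so that
-- it is only used through the two reflection lemmas).
opaque
  eqFunᵇ : {n m : ℕ} → (Fin n → Fin m) → (Fin n → Fin m) → Bool
  eqFunᵇ {n} f g = allB (λ i → f i ≟Fᵇ g i) (allFin n)

  eqFunᵇ→ : {n m : ℕ} {f g : Fin n → Fin m} → T (eqFunᵇ f g) → ∀ i → f i ≡ g i
  eqFunᵇ→ {f = f} {g} t i = ≟Fᵇ→ {i = f i} {g i} (allB-tabulate→ (λ i → f i ≟Fᵇ g i) id t i)

  eqFunᵇ← : {n m : ℕ} {f g : Fin n → Fin m} → (∀ i → f i ≡ g i) → T (eqFunᵇ f g)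
  eqFunᵇ← {f = f} {g} e = allB-tabulate← (λ i → f i ≟Fᵇ g i) id (λ i → ≟Fᵇ← {i = f i} {g i} (e i))

-- An enumeration of X up to a Boolean equivalence eq: the list meets
-- every eq-class exactly once, expressed by the fact that a class-invariant
-- function supported on the class of c sums to its value at c.
record Enumeration (X : Set) : Set₁ where
  field
    eq       : X → X → Bool
    list     : List X
    eq-refl  : ∀ x → T (eq x x)
    eq-sym   : ∀ x y → T (eq x y) → T (eq y x)
    eq-trans : ∀ x y z → T (eq x y) → T (eq y z) → T (eq x z)
    single   : ∀ (h : X → ℕ) c → (∀ x y → T (eq x y) → h x ≡ h y) →
               (∀ x → ¬ T (eq x c) → h x ≡ 0) → sumL h list ≡ h c

  eq-respˡ : ∀ x x' z → T (eq x x') → eq x z ≡ eq x' z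
  eq-respˡ x x' z t = T-ext (eq-trans x' x z (eq-sym x x' t)) (eq-trans x x' z t)

  eq-respʳ : ∀ z x x' → T (eq x x') → eq z x ≡ eq z x'
  eq-respʳ z x x' t = T-ext (λ u → eq-trans z x x' u t) (λ u → eq-trans z x' x u (eq-sym x x' t))

  count-class : ∀ c → sumL (λ x → ⟦ eq x c ⟧) list ≡ 1
  count-class c = trans (single (λ x → ⟦ eq x c ⟧) c (λ x y t → cong ⟦_⟧ (eq-respˡ x y c t))
                                (λ x nt → cong ⟦_⟧ (¬T→false nt)))
                        (cong ⟦_⟧ (T→true (eq-refl c)))

  two-solutions : (p : X → Bool) → (∀ x y → T (eq x y) → p x ≡ p y) →
                  ∀ τ₁ τ₂ → T (p τ₁) → T (p τ₂) → ¬ T (eq τ₁ τ₂) → 2 ≤ sumL (⟦_⟧ ∘ p) list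
  two-solutions p p-resp τ₁ τ₂ p₁ p₂ τ₁≉τ₂ =
    subst (_≤ sumL (⟦_⟧ ∘ p) list)
          (trans (sumL-+ _ _ list) (cong₂ _+_ (count-class τ₁) (count-class τ₂)))
          (sumL-mono list pointwise)
    where
    pointwise : ∀ σ → ⟦ eq σ τ₁ ⟧ + ⟦ eq σ τ₂ ⟧ ≤ ⟦ p σ ⟧
    pointwise σ with eq σ τ₁ in e₁ | eq σ τ₂ in e₂
    ... | false | false = z≤n
    ... | true  | true  = ⊥-elim (τ₁≉τ₂ (eq-trans τ₁ σ τ₂ (eq-sym σ τ₁ (true→T e₁)) (true→T e₂)))
    ... | true  | false rewrite p-resp σ τ₁ (true→T e₁) | T→true p₁ = ≤-refl
    ... | false | true  rewrite p-resp σ τ₂ (true→T e₂) | T→true p₂ = ≤-refl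

finEnumeration : (n : ℕ) → Enumeration (Fin n)
finEnumeration n = record
  { eq       = _≟Fᵇ_
  ; list     = allFin n
  ; eq-refl  = λ x → ≟Fᵇ← {i = x} refl
  ; eq-sym   = λ x y t → ≟Fᵇ← {i = y} {x} (sym (≟Fᵇ→ {i = x} {y} t))
  ; eq-trans = λ x y z t u → ≟Fᵇ← {i = x} {z} (trans (≟Fᵇ→ {i = x} {y} t) (≟Fᵇ→ {i = y} {z} u))
  ; single   = λ h c _ z → trans (sumL-tabulate h id)
                                 (sumFin-single h c (λ x ne → z x (ne ∘ ≟Fᵇ→ {i = x} {c})))
  }

extend : {n m : ℕ} → Fin m → (Fin n → Fin m) → Fin (suc n) → Fin m
extend v f F.zero    = v
extend v f (F.suc i) = f i

allFuns-single : (n m : ℕ) (h : (Fin n → Fin m) → ℕ) (c : Fin n → Fin m) →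
                 (∀ x y → T (eqFunᵇ x y) → h x ≡ h y) → (∀ x → ¬ T (eqFunᵇ x c) → h x ≡ 0) →
                 sumL h (allFuns n m) ≡ h c
allFuns-single zero m h c resp z = trans (+-identityʳ _) (resp _ _ (eqFunᵇ← {n = 0} {m} (λ ())))
allFuns-single (suc n) m h c resp z =
  trans (sumL-concatMap h _ (allFuns n m))
  (trans (sumL-cong (allFuns n m) (heads _ (λ _ _ → refl) (λ _ _ _ → refl)))
  (trans (allFuns-single n m (h ∘ extend (c F.zero)) (c ∘ F.suc)
            (λ x y t → resp _ _ (eqFunᵇ← λ { F.zero → refl ; (F.suc i) → eqFunᵇ→ t i }))
            (λ x nt → z _ (λ t → nt (eqFunᵇ← (λ i → eqFunᵇ→ t (F.suc i))))))
         (resp _ _ (eqFunᵇ← λ { F.zero → refl ; (F.suc i) → refl }))))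
  where
  -- the inner sum over the head: only v = c 0 contributes.  (cons is
  -- abstracted because allFuns uses its own local copy of extend.)
  heads : (cons : Fin m → (Fin n → Fin m) → Fin (suc n) → Fin m) →
          (∀ v f → cons v f F.zero ≡ v) → (∀ v f i → cons v f (F.suc i) ≡ f i) →
          ∀ f → sumL h (map (λ v → cons v f) (allFin m)) ≡ h (extend (c F.zero) f)
  heads cons cons-0 cons-s f =
    trans (sumL-map h (λ v → cons v f) (allFin m))
    (trans (sumL-tabulate (λ v → h (cons v f)) id)
    (trans (sumFin-single (λ v → h (cons v f)) (c F.zero)
              (λ v ne → z (cons v f) (λ t → ne (trans (sym (cons-0 v f)) (eqFunᵇ→ t F.zero)))))
           (resp _ _ (eqFunᵇ← λ { F.zero → cons-0 (c F.zero) f ; (F.suc i) → cons-s (c F.zero) f i }))))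

funEnumeration : (n m : ℕ) → Enumeration (Fin n → Fin m)
funEnumeration n m = record
  { eq       = eqFunᵇ
  ; list     = allFuns n m
  ; eq-refl  = λ x → eqFunᵇ← (λ i → refl)
  ; eq-sym   = λ x y t → eqFunᵇ← (λ i → sym (eqFunᵇ→ t i))
  ; eq-trans = λ x y z t u → eqFunᵇ← (λ i → trans (eqFunᵇ→ t i) (eqFunᵇ→ u i))
  ; single   = allFuns-single n m
  }

-- Proof: both counts equal the double sum
-- Σ_x Σ_y [p x ∧ x ≈ φ y].
module _ {X Y : Set} (EX : Enumeration X) (EY : Enumeration Y) where
  private
    module EX = Enumeration EX
    module EY = Enumeration EY

  count-bijection :
    (p : X → Bool) (q : Y → Bool) (φ : Y → X) (ψ : X → Y) →
    (∀ x x' → T (EX.eq x x') → p x ≡ p x') →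
    (∀ y y' → T (EY.eq y y') → T (EX.eq (φ y) (φ y'))) →
    (∀ y → q y ≡ p (φ y)) →
    (∀ x → T (p x) → T (EX.eq x (φ (ψ x)))) →
    (∀ x y → T (EX.eq x (φ y)) → T (EY.eq y (ψ x))) →
    sumL (⟦_⟧ ∘ q) EY.list ≡ sumL (⟦_⟧ ∘ p) EX.list
  count-bijection p q φ ψ p-resp φ-resp q≡p∘φ section retraction =
    trans (sumL-cong EY.list over-x)
    (trans (sym (sumL-swap H EX.list EY.list))
           (sumL-cong EX.list over-y))
    where
    H : X → Y → ℕ
    H x y = ⟦ p x ∧ EX.eq x (φ y) ⟧

    -- for fixed y only the class of φ y contributes
    over-x : ∀ y → ⟦ q y ⟧ ≡ sumL (λ x → H x y) EX.list
    over-x y = sym (trans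
      (EX.single (λ x → H x y) (φ y)
        (λ x x' t → cong₂ (λ a b → ⟦ a ∧ b ⟧) (p-resp x x' t) (EX.eq-respˡ x x' (φ y) t))
        (λ x nt → trans (cong (λ b → ⟦ p x ∧ b ⟧) (¬T→false nt)) (cong ⟦_⟧ (Bool.∧-zeroʳ (p x)))))
      (trans (cong (λ b → ⟦ p (φ y) ∧ b ⟧) (T→true (EX.eq-refl (φ y))))
             (cong ⟦_⟧ (trans (Bool.∧-identityʳ (p (φ y))) (sym (q≡p∘φ y))))))

    -- for fixed x only the class of ψ x contributes
    over-y : ∀ x → sumL (H x) EY.list ≡ ⟦ p x ⟧
    over-y x = trans (EY.single (H x) (ψ x)
        (λ y y' t → cong (λ b → ⟦ p x ∧ b ⟧) (EX.eq-respʳ x (φ y) (φ y') (φ-resp y y' t)))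
        off-class)
        at-ψx
      where
      off-class : ∀ y → ¬ T (EY.eq y (ψ x)) → H x y ≡ 0
      off-class y nt with p x | EX.eq x (φ y) in e
      ... | false | _     = refl
      ... | true  | false = refl
      ... | true  | true  = ⊥-elim (nt (retraction x y (true→T e)))
      at-ψx : H x (ψ x) ≡ ⟦ p x ⟧
      at-ψx with p x in e
      ... | false = refl
      ... | true rewrite T→true (section x (true→T e)) = refl

isPartition : (P : RawPoset) {m : ℕ} → Vec ℕ m → (Fin (size P) → Fin m) → Bool
isPartition P α σ = orderPreservingᵇ P σ ∧ hasContentᵇ P α σ

coeffK-sumL : (P : RawPoset) {m : ℕ} (α : Vec ℕ m) →
              coeffK P α ≡ sumL (⟦_⟧ ∘ isPartition P α) (allFuns (size P) m)
coeffK-sumL P {m} α = countB-sumL (isPartition P α) (allFuns (size P) m)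

OrderPreserving : (P : RawPoset) {m : ℕ} → (Fin (size P) → Fin m) → Set
OrderPreserving P σ = ∀ x y → T (le P x y) → toℕ (σ x) ≤ toℕ (σ y)

fiberSize : {n m : ℕ} → (Fin n → Fin m) → Fin m → ℕ
fiberSize σ i = count (λ x → σ x ≟Fᵇ i)

HasContent : (P : RawPoset) {m : ℕ} → Vec ℕ m → (Fin (size P) → Fin m) → Set
HasContent P α σ = ∀ i → fiberSize σ i ≡ lookup α i

fiberSize-cong : {n m : ℕ} (σ σ' : Fin n → Fin m) → (∀ x → σ x ≡ σ' x) → ∀ i → fiberSize σ i ≡ fiberSize σ' i
fiberSize-cong σ σ' e i = sumFin-cong (λ x → cong (λ v → ⟦ v ≟Fᵇ i ⟧) (e x))

fiberSize-const : {n m : ℕ} (c i : Fin m) → fiberSize {n} (λ _ → c) i ≡ n * ⟦ c ≟Fᵇ i ⟧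
fiberSize-const {n} c i = sumFin-const n _

module _ (P : RawPoset) {m : ℕ} (σ : Fin (size P) → Fin m) where

  orderPreserving→ : T (orderPreservingᵇ P σ) → OrderPreserving P σ
  orderPreserving→ t x y l =
    ≤ᵇ⇒≤ _ _ (implies (le P x y) l (allB-tabulate→ _ id (allB-tabulate→ _ id t x) y))
    where
    implies : ∀ a {b} → T a → T (not a ∨ b) → T b
    implies true _ u = u

  orderPreserving← : OrderPreserving P σ → T (orderPreservingᵇ P σ)
  orderPreserving← o =
    allB-tabulate← _ id (λ x → allB-tabulate← _ id (λ y → implies (le P x y) (≤⇒≤ᵇ ∘ o x y)))
    where
    implies : ∀ a {b} → (T a → T b) → T (not a ∨ b)
    implies true  f = f tt
    implies false f = tt

  countB-fiberSize : (i : Fin m) → countB (λ x → σ x ≟Fᵇ i) (allFin (size P)) ≡ fiberSize σ i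
  countB-fiberSize i = trans (countB-sumL (λ x → σ x ≟Fᵇ i) (allFin (size P)))
                             (sumL-tabulate (λ x → ⟦ σ x ≟Fᵇ i ⟧) id)

  hasContent→ : (α : Vec ℕ m) → T (hasContentᵇ P α σ) → HasContent P α σ
  hasContent→ α t i = trans (sym (countB-fiberSize i)) (≡ᵇ⇒≡ _ _ (allB-tabulate→ _ id t i))

  hasContent← : (α : Vec ℕ m) → HasContent P α σ → T (hasContentᵇ P α σ)
  hasContent← α h = allB-tabulate← _ id (λ i → ≡⇒≡ᵇ _ _ (trans (countB-fiberSize i) (h i)))

  isPartition→ : (α : Vec ℕ m) → T (isPartition P α σ) → OrderPreserving P σ × HasContent P α σ
  isPartition→ α t with orderPreservingᵇ P σ in e₁ | hasContentᵇ P α σ in e₂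
  ... | true | true = orderPreserving→ (true→T e₁) , hasContent→ α (true→T e₂)

  isPartition← : (α : Vec ℕ m) → OrderPreserving P σ → HasContent P α σ → T (isPartition P α σ)
  isPartition← α o h
    with orderPreservingᵇ P σ | orderPreserving← o | hasContentᵇ P α σ | hasContent← α h
  ... | true | _ | true | _ = tt

isPartition-≡ : (P P' : RawPoset) {m : ℕ} (α α' : Vec ℕ m)
                (σ : Fin (size P) → Fin m) (σ' : Fin (size P') → Fin m) →
                (OrderPreserving P σ → OrderPreserving P' σ') → (OrderPreserving P' σ' → OrderPreserving P σ) →
                (HasContent P α σ → HasContent P' α' σ') → (HasContent P' α' σ' → HasContent P α σ) →
                isPartition P α σ ≡ isPartition P' α' σ'
isPartition-≡ P P' α α' σ σ' op→ op← hc→ hc← = T-ext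
  (λ t → let (o , h) = isPartition→ P σ α t in isPartition← P' σ' α' (op→ o) (hc→ h))
  (λ t → let (o , h) = isPartition→ P' σ' α' t in isPartition← P σ α (op← o) (hc← h))

isPartition-resp : (P : RawPoset) {m : ℕ} (α : Vec ℕ m) (σ σ' : Fin (size P) → Fin m) →
                   T (eqFunᵇ σ σ') → isPartition P α σ ≡ isPartition P α σ'
isPartition-resp P α σ σ' t = isPartition-≡ P P α α σ σ'
  (λ o x y l → subst₂ _≤_ (cong toℕ (e x)) (cong toℕ (e y)) (o x y l))
  (λ o x y l → subst₂ _≤_ (cong toℕ (sym (e x))) (cong toℕ (sym (e y))) (o x y l))
  (λ h i → trans (sym (fiberSize-cong σ σ' e i)) (h i))
  (λ h i → trans (fiberSize-cong σ σ' e i) (h i))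
  where
  e : ∀ x → σ x ≡ σ' x
  e = eqFunᵇ→ t

coeffK-unique : (P : RawPoset) {m : ℕ} (α : Vec ℕ m) (c : Fin (size P) → Fin m) →
                T (isPartition P α c) → (∀ σ → T (isPartition P α σ) → ∀ x → σ x ≡ c x) →
                coeffK P α ≡ 1
coeffK-unique P {m} α c pc unique = trans (coeffK-sumL P α)
  (trans (allFuns-single (size P) m (⟦_⟧ ∘ isPartition P α) c
            (λ x y t → cong ⟦_⟧ (isPartition-resp P α x y t)) off-c)
         (cong ⟦_⟧ (T→true pc)))
  where
  off-c : ∀ σ → ¬ T (eqFunᵇ σ c) → ⟦ isPartition P α σ ⟧ ≡ 0
  off-c σ nt with isPartition P α σ in e
  ... | false = refl
  ... | true  = ⊥-elim (nt (eqFunᵇ← (unique σ (true→T e))))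

coeffK-transfer : (C D : RawPoset) {m : ℕ} (γ δ : Vec ℕ m)
                  (ι : Fin (size C) → Fin (size D)) (φ : (Fin (size C) → Fin m) → Fin (size D) → Fin m) →
                  (∀ τ τ' → (∀ x → τ x ≡ τ' x) → ∀ u → φ τ u ≡ φ τ' u) →
                  (∀ τ x → φ τ (ι x) ≡ τ x) →
                  (∀ τ → isPartition C γ τ ≡ isPartition D δ (φ τ)) →
                  (∀ σ → T (isPartition D δ σ) → ∀ u → σ u ≡ φ (σ ∘ ι) u) →
                  coeffK C γ ≡ coeffK D δ
coeffK-transfer C D {m} γ δ ι φ φ-cong φ-ι transported extension = trans (coeffK-sumL C γ)
  (trans (count-bijection (funEnumeration (size D) m) (funEnumeration (size C) m)
            (isPartition D δ) (isPartition C γ) φ (_∘ ι)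
            (isPartition-resp D δ)
            (λ τ τ' t → eqFunᵇ← (φ-cong τ τ' (eqFunᵇ→ t)))
            transported
            (λ σ t → eqFunᵇ← (extension σ t))
            (λ σ τ t → eqFunᵇ← (λ x → trans (sym (φ-ι τ x)) (sym (eqFunᵇ→ t (ι x))))))
         (sym (coeffK-sumL D δ)))

-- K_P is an invariant of isomorphism: transfer along ι = to, φ τ = τ ∘ from.
module _ (P S : RawPoset) (I : P ≅ S) where
  open _≅_ I

  fiberSize-iso : {m : ℕ} (τ : Fin (size P) → Fin m) (i : Fin m) → fiberSize τ i ≡ fiberSize (τ ∘ from) i
  fiberSize-iso τ i = trans (sym (sumL-tabulate (λ x → ⟦ τ x ≟Fᵇ i ⟧) id))
    (trans (count-bijection (finEnumeration (size S)) (finEnumeration (size P))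
              (λ y → τ (from y) ≟Fᵇ i) (λ x → τ x ≟Fᵇ i) to from
              (λ x x' t → cong (λ z → τ (from z) ≟Fᵇ i) (≟Fᵇ→ {i = x} {x'} t))
              (λ y y' t → ≟Fᵇ← {i = to y} {to y'} (cong to (≟Fᵇ→ {i = y} {y'} t)))
              (λ x → cong (λ z → τ z ≟Fᵇ i) (sym (from∘to x)))
              (λ x _ → ≟Fᵇ← {i = x} (sym (to∘from x)))
              (λ x y t → ≟Fᵇ← {i = y} (trans (sym (from∘to y)) (cong from (sym (≟Fᵇ→ {i = x} {to y} t))))))
           (sumL-tabulate (λ y → ⟦ τ (from y) ≟Fᵇ i ⟧) id))

  coeffK-iso : {m : ℕ} (α : Vec ℕ m) → coeffK P α ≡ coeffK S α
  coeffK-iso α = coeffK-transfer P S α α to (_∘ from)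
    (λ τ τ' e u → e (from u))
    (λ τ x → cong τ (from∘to x))
    transported
    (λ σ _ u → cong σ (sym (to∘from u)))
    where
    le-from : ∀ x' y' → le S x' y' ≡ le P (from x') (from y')
    le-from x' y' = trans (cong₂ (le S) (sym (to∘from x')) (sym (to∘from y'))) (sym (pres (from x') (from y')))

    transported : ∀ τ → isPartition P α τ ≡ isPartition S α (τ ∘ from)
    transported τ = isPartition-≡ P S α α τ (τ ∘ from)
      (λ o x' y' l → o (from x') (from y') (subst T (le-from x' y') l))
      (λ o x y l → subst₂ _≤_ (cong (toℕ ∘ τ) (from∘to x)) (cong (toℕ ∘ τ) (from∘to y))
                          (o (to x) (to y) (subst T (pres x y) l)))
      (λ h i → trans (sym (fiberSize-iso τ i)) (h i))
      (λ h i → trans (fiberSize-iso τ i) (h i))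

module _ (A B : RawPoset) where
  private
    a b : ℕ
    a = size A
    b = size B

  le-⊕ : Fin a ⊎ Fin b → Fin a ⊎ Fin b → Bool
  le-⊕ (inj₁ i) (inj₁ j) = le A i j
  le-⊕ (inj₂ i) (inj₂ j) = le B i j
  le-⊕ (inj₁ _) (inj₂ _) = true
  le-⊕ (inj₂ _) (inj₁ _) = false

  le⊕-splitAt : ∀ u v → le (A ⊕ B) u v ≡ le-⊕ (splitAt a u) (splitAt a v)
  le⊕-splitAt u v with splitAt a u | splitAt a v
  ... | inj₁ i | inj₁ j = refl
  ... | inj₁ i | inj₂ j = refl
  ... | inj₂ i | inj₁ j = refl
  ... | inj₂ i | inj₂ j = refl

  le⊕-ll : ∀ x y → le (A ⊕ B) (x ↑ˡ b) (y ↑ˡ b) ≡ le A x y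
  le⊕-ll x y rewrite le⊕-splitAt (x ↑ˡ b) (y ↑ˡ b) | splitAt-↑ˡ a x b | splitAt-↑ˡ a y b = refl

  le⊕-rr : ∀ x y → le (A ⊕ B) (a ↑ʳ x) (a ↑ʳ y) ≡ le B x y
  le⊕-rr x y rewrite le⊕-splitAt (a ↑ʳ x) (a ↑ʳ y) | splitAt-↑ʳ a b x | splitAt-↑ʳ a b y = refl

  le⊕-lr : ∀ x y → le (A ⊕ B) (x ↑ˡ b) (a ↑ʳ y) ≡ true
  le⊕-lr x y rewrite le⊕-splitAt (x ↑ˡ b) (a ↑ʳ y) | splitAt-↑ˡ a x b | splitAt-↑ʳ a b y = refl

  glue : {X : Set} → (Fin a → X) → (Fin b → X) → Fin (a + b) → X
  glue f g u = [ f , g ]′ (splitAt a u)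

  glue-l : {X : Set} (f : Fin a → X) (g : Fin b → X) (x : Fin a) → glue f g (x ↑ˡ b) ≡ f x
  glue-l f g x rewrite splitAt-↑ˡ a x b = refl

  glue-r : {X : Set} (f : Fin a → X) (g : Fin b → X) (y : Fin b) → glue f g (a ↑ʳ y) ≡ g y
  glue-r f g y rewrite splitAt-↑ʳ a b y = refl

  glue-cong : {m : ℕ} (f f' : Fin a → Fin m) (g g' : Fin b → Fin m) →
              (∀ x → f x ≡ f' x) → (∀ y → g y ≡ g' y) → ∀ u → glue f g u ≡ glue f' g' u
  glue-cong f f' g g' e e' u with splitAt a u
  ... | inj₁ x = e x
  ... | inj₂ y = e' y

  glue-restrict : {X : Set} (σ : Fin (a + b) → X) → ∀ u → σ u ≡ glue (σ ∘ (_↑ˡ b)) (σ ∘ (a ↑ʳ_)) u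
  glue-restrict σ u with splitAt a u in e
  ... | inj₁ x = cong σ (sym (splitAt⁻¹-↑ˡ e))
  ... | inj₂ y = cong σ (sym (splitAt⁻¹-↑ʳ e))

  glue-orderPreserving : {m : ℕ} (f : Fin a → Fin m) (g : Fin b → Fin m) →
                         OrderPreserving A f → OrderPreserving B g → (∀ x y → toℕ (f x) ≤ toℕ (g y)) →
                         OrderPreserving (A ⊕ B) (glue f g)
  glue-orderPreserving f g of og f≤g u v l with splitAt a u | splitAt a v | le⊕-splitAt u v
  ... | inj₁ i | inj₁ j | e = of i j (subst T e l)
  ... | inj₁ i | inj₂ j | e = f≤g i j
  ... | inj₂ i | inj₂ j | e = og i j (subst T e l)
  ... | inj₂ i | inj₁ j | e with () ← subst T e l

  glue-orderPreserving-l : {m : ℕ} (f : Fin a → Fin m) (g : Fin b → Fin m) →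
                           OrderPreserving (A ⊕ B) (glue f g) → OrderPreserving A f
  glue-orderPreserving-l f g o x y l = subst₂ _≤_ (cong toℕ (glue-l f g x)) (cong toℕ (glue-l f g y))
    (o (x ↑ˡ b) (y ↑ˡ b) (subst T (sym (le⊕-ll x y)) l))

  glue-orderPreserving-r : {m : ℕ} (f : Fin a → Fin m) (g : Fin b → Fin m) →
                           OrderPreserving (A ⊕ B) (glue f g) → OrderPreserving B g
  glue-orderPreserving-r f g o x y l = subst₂ _≤_ (cong toℕ (glue-r f g x)) (cong toℕ (glue-r f g y))
    (o (a ↑ʳ x) (a ↑ʳ y) (subst T (sym (le⊕-rr x y)) l))

  fiberSize-split : {m : ℕ} (σ : Fin (a + b) → Fin m) (i : Fin m) →
                    fiberSize σ i ≡ fiberSize (σ ∘ (_↑ˡ b)) i + fiberSize (σ ∘ (a ↑ʳ_)) i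
  fiberSize-split σ i = sumFin-split a b (λ x → ⟦ σ x ≟Fᵇ i ⟧)

  fiberSize-glue : {m : ℕ} (f : Fin a → Fin m) (g : Fin b → Fin m) (i : Fin m) →
                   fiberSize (glue f g) i ≡ fiberSize f i + fiberSize g i
  fiberSize-glue f g i = trans (fiberSize-split (glue f g) i)
    (cong₂ _+_ (fiberSize-cong _ _ (glue-l f g) i) (fiberSize-cong _ _ (glue-r f g) i))

addAt : {n : ℕ} → Vec ℕ n → Fin n → ℕ → Vec ℕ n
addAt (x ∷ xs) F.zero    k = (x + k) ∷ xs
addAt (x ∷ xs) (F.suc j) k = x ∷ addAt xs j k

lookup-addAt : {n : ℕ} (v : Vec ℕ n) (j i : Fin n) (k : ℕ) → lookup (addAt v j k) i ≡ lookup v i + k * ⟦ j ≟Fᵇ i ⟧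
lookup-addAt (x ∷ xs) F.zero    F.zero    k = cong (x +_) (sym (*-identityʳ k))
lookup-addAt (x ∷ xs) F.zero    (F.suc i) k = sym (trans (cong (lookup xs i +_) (*-zeroʳ k)) (+-identityʳ _))
lookup-addAt (x ∷ xs) (F.suc j) F.zero    k = sym (trans (cong (x +_) (*-zeroʳ k)) (+-identityʳ x))
lookup-addAt (x ∷ xs) (F.suc j) (F.suc i) k = lookup-addAt xs j i k

lookup-addAt-same : {n : ℕ} (v : Vec ℕ n) (j : Fin n) (k : ℕ) → k ≤ lookup (addAt v j k) j
lookup-addAt-same v j k rewrite lookup-addAt v j j k | ≟Fᵇ-refl j | *-identityʳ k = m≤n+m k (lookup v j)

module _ {n n' m : ℕ} (τ : Fin n → Fin m) (σ' : Fin n' → Fin m) (c : Fin m) (k : ℕ) (β : Vec ℕ m)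
         (shift : ∀ i → fiberSize σ' i ≡ fiberSize τ i + k * ⟦ c ≟Fᵇ i ⟧) where

  content-shift→ : (∀ i → fiberSize τ i ≡ lookup β i) → ∀ i → fiberSize σ' i ≡ lookup (addAt β c k) i
  content-shift→ h i = trans (shift i) (trans (cong (_+ k * ⟦ c ≟Fᵇ i ⟧) (h i)) (sym (lookup-addAt β c i k)))

  content-shift← : (∀ i → fiberSize σ' i ≡ lookup (addAt β c k) i) → ∀ i → fiberSize τ i ≡ lookup β i
  content-shift← h i = +-cancelʳ-≡ _ (fiberSize τ i) (lookup β i)
    (trans (sym (shift i)) (trans (h i) (lookup-addAt β c i k)))

-- In a partition of A ⊕ B with content
-- β + |B|·e_top every element of B takes the top value: otherwise some
-- y ∈ B has a smaller value, every element of A lies below it, so fewer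
-- than |B| elements reach the top value.
module _ (A B : RawPoset) {m : ℕ} (β : Vec ℕ (suc m)) where
  private
    a b : ℕ
    a = size A
    b = size B
    top : Fin (suc m)
    top = fromℕ m
    α : Vec ℕ (suc m)
    α = addAt β top b

  top-forced : (σ : Fin (a + b) → Fin (suc m)) → T (isPartition (A ⊕ B) α σ) → ∀ y → σ (a ↑ʳ y) ≡ top
  top-forced σ p y₀ with σ (a ↑ʳ y₀) F.≟ top
  ... | yes e = e
  ... | no ne = ⊥-elim (<⇒≱ top-fiber< top-fiber≥)
    where
    op : OrderPreserving (A ⊕ B) σ
    op = proj₁ (isPartition→ (A ⊕ B) σ α p)
    v<m : toℕ (σ (a ↑ʳ y₀)) < m
    v<m = ≤∧≢⇒< (s≤s⁻¹ (toℕ<n (σ (a ↑ʳ y₀)))) (λ e → ne (toℕ-injective (trans e (sym (toℕ-fromℕ m)))))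
    A-below : ∀ x → (σ (x ↑ˡ b) ≟Fᵇ top) ≡ false
    A-below x = ≟Fᵇ-≢ λ e → <⇒≱ v<m (subst (_≤ toℕ (σ (a ↑ʳ y₀))) (trans (cong toℕ e) (toℕ-fromℕ m))
                  (op (x ↑ˡ b) (a ↑ʳ y₀) (subst T (sym (le⊕-lr A B x y₀)) tt)))
    top-fiber< : fiberSize σ top < b
    top-fiber< = subst (_< b) (sym (trans (fiberSize-split A B σ top)
                   (cong (_+ fiberSize (σ ∘ (a ↑ʳ_)) top) (count-empty _ A-below))))
                 (count-< (λ y → σ (a ↑ʳ y) ≟Fᵇ top) y₀ (≟Fᵇ-≢ ne))
    top-fiber≥ : b ≤ fiberSize σ top
    top-fiber≥ = subst (b ≤_) (sym (proj₂ (isPartition→ (A ⊕ B) σ α p) top)) (lookup-addAt-same β top b)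

  peel-top : coeffK A β ≡ coeffK (A ⊕ B) α
  peel-top = coeffK-transfer A (A ⊕ B) β α (_↑ˡ b) φ
    (λ τ τ' e → glue-cong A B τ τ' _ _ e (λ _ → refl))
    (λ τ → glue-l A B τ _)
    transported
    (λ σ p u → trans (glue-restrict A B σ u) (glue-cong A B _ _ _ _ (λ _ → refl) (top-forced σ p) u))
    where
    φ : (Fin a → Fin (suc m)) → Fin (a + b) → Fin (suc m)
    φ τ = glue A B τ (λ _ → top)
    below-top : ∀ (τ : Fin a → Fin (suc m)) x (y : Fin b) → toℕ (τ x) ≤ toℕ top
    below-top τ x y = subst (toℕ (τ x) ≤_) (sym (toℕ-fromℕ m)) (s≤s⁻¹ (toℕ<n (τ x)))
    shift : ∀ τ i → fiberSize (φ τ) i ≡ fiberSize τ i + b * ⟦ top ≟Fᵇ i ⟧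
    shift τ i = trans (fiberSize-glue A B τ _ i) (cong (fiberSize τ i +_) (fiberSize-const {b} top i))
    transported : ∀ τ → isPartition A β τ ≡ isPartition (A ⊕ B) α (φ τ)
    transported τ = isPartition-≡ A (A ⊕ B) β α τ (φ τ)
      (λ o → glue-orderPreserving A B τ _ o (λ _ _ _ → ≤-refl) (below-top τ))
      (glue-orderPreserving-l A B τ _)
      (content-shift→ τ (φ τ) top b β (shift τ))
      (content-shift← τ (φ τ) top b β (shift τ))

-- Peeling off the bottom summand, dually: with content γ + |A|·e_bottom
-- every element of A takes the bottom value.
module _ (A B : RawPoset) {m : ℕ} (γ : Vec ℕ (suc m)) where
  private
    a b : ℕ
    a = size A
    b = size B
    bot : Fin (suc m)
    bot = F.zero
    α : Vec ℕ (suc m)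
    α = addAt γ bot a

  bottom-forced : (σ : Fin (a + b) → Fin (suc m)) → T (isPartition (A ⊕ B) α σ) → ∀ x → σ (x ↑ˡ b) ≡ bot
  bottom-forced σ p x₀ with σ (x₀ ↑ˡ b) F.≟ bot
  ... | yes e = e
  ... | no ne = ⊥-elim (<⇒≱ bottom-fiber< bottom-fiber≥)
    where
    op : OrderPreserving (A ⊕ B) σ
    op = proj₁ (isPartition→ (A ⊕ B) σ α p)
    0<v : 0 < toℕ (σ (x₀ ↑ˡ b))
    0<v = n≢0⇒n>0 (λ e → ne (toℕ-injective e))
    B-above : ∀ y → (σ (a ↑ʳ y) ≟Fᵇ bot) ≡ false
    B-above y = ≟Fᵇ-≢ λ e → <⇒≱ 0<v (subst (toℕ (σ (x₀ ↑ˡ b)) ≤_) (cong toℕ e)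
                  (op (x₀ ↑ˡ b) (a ↑ʳ y) (subst T (sym (le⊕-lr A B x₀ y)) tt)))
    bottom-fiber< : fiberSize σ bot < a
    bottom-fiber< = subst (_< a) (sym (trans (fiberSize-split A B σ bot)
                      (trans (cong (fiberSize (σ ∘ (_↑ˡ b)) bot +_) (count-empty _ B-above)) (+-identityʳ _))))
                    (count-< (λ x → σ (x ↑ˡ b) ≟Fᵇ bot) x₀ (≟Fᵇ-≢ ne))
    bottom-fiber≥ : a ≤ fiberSize σ bot
    bottom-fiber≥ = subst (a ≤_) (sym (proj₂ (isPartition→ (A ⊕ B) σ α p) bot)) (lookup-addAt-same γ bot a)

  peel-bottom : coeffK B γ ≡ coeffK (A ⊕ B) α
  peel-bottom = coeffK-transfer B (A ⊕ B) γ α (a ↑ʳ_) φ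
    (λ τ τ' e → glue-cong A B _ _ τ τ' (λ _ → refl) e)
    (λ τ → glue-r A B _ τ)
    transported
    (λ σ p u → trans (glue-restrict A B σ u) (glue-cong A B _ _ _ _ (bottom-forced σ p) (λ _ → refl) u))
    where
    φ : (Fin b → Fin (suc m)) → Fin (a + b) → Fin (suc m)
    φ τ = glue A B (λ _ → bot) τ
    shift : ∀ τ i → fiberSize (φ τ) i ≡ fiberSize τ i + a * ⟦ bot ≟Fᵇ i ⟧
    shift τ i = trans (fiberSize-glue A B _ τ i) (trans (cong (_+ fiberSize τ i) (fiberSize-const {a} bot i))
                                                       (+-comm _ (fiberSize τ i)))
    transported : ∀ τ → isPartition B γ τ ≡ isPartition (A ⊕ B) α (φ τ)
    transported τ = isPartition-≡ B (A ⊕ B) γ α τ (φ τ)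
      (λ o → glue-orderPreserving A B _ τ (λ _ _ _ → z≤n) o (λ _ _ → z≤n))
      (glue-orderPreserving-r A B _ τ)
      (content-shift→ τ (φ τ) bot a γ (shift τ))
      (content-shift← τ (φ τ) bot a γ (shift τ))

-- K_P determines |P|, read off from the coefficient of x₁^k: the only map
-- P → [1] is constant, and it has content (k) exactly when |P| = k.
fin1 : (i : Fin 1) → i ≡ F.zero
fin1 F.zero = refl

module _ (S : RawPoset) where
  const₀ : Fin (size S) → Fin 1
  const₀ _ = F.zero

  coeffK-one-variable : (k : ℕ) → coeffK S (k ∷ []) ≡ ⟦ isPartition S (k ∷ []) const₀ ⟧
  coeffK-one-variable k = trans (coeffK-sumL S (k ∷ []))
    (allFuns-single (size S) 1 (⟦_⟧ ∘ isPartition S (k ∷ [])) const₀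
      (λ x y t → cong ⟦_⟧ (isPartition-resp S (k ∷ []) x y t))
      (λ x nt → ⊥-elim (nt (eqFunᵇ← (fin1 ∘ x)))))

  const₀-content : (k : ℕ) → T (isPartition S (k ∷ []) const₀) → size S ≡ k
  const₀-content k p = trans (sym (trans (fiberSize-const {size S} {1} F.zero F.zero) (*-identityʳ _)))
                             (proj₂ (isPartition→ S const₀ (k ∷ []) p) F.zero)

  const₀-partition : T (isPartition S (size S ∷ []) const₀)
  const₀-partition = isPartition← S const₀ (size S ∷ []) (λ _ _ _ → z≤n)
    λ { F.zero → trans (fiberSize-const {size S} {1} F.zero F.zero) (*-identityʳ _) }

sameK-size : (S S' : RawPoset) → SameK S S' → size S ≡ size S'
sameK-size S S' sk = sym (const₀-content S' (size S) (one→T (isPartition S' (size S ∷ []) (const₀ S')) one))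
  where
  one : 1 ≡ ⟦ isPartition S' (size S ∷ []) (const₀ S') ⟧
  one = begin
    1                                                  ≡⟨ cong ⟦_⟧ (sym (T→true (const₀-partition S))) ⟩
    ⟦ isPartition S (size S ∷ []) (const₀ S) ⟧         ≡⟨ sym (coeffK-one-variable S (size S)) ⟩
    coeffK S (size S ∷ [])                             ≡⟨ sk 1 (size S ∷ []) ⟩
    coeffK S' (size S ∷ [])                            ≡⟨ coeffK-one-variable S' (size S) ⟩
    ⟦ isPartition S' (size S ∷ []) (const₀ S') ⟧       ∎
    where open ≡-Reasoning
  one→T : ∀ b → 1 ≡ ⟦ b ⟧ → T b
  one→T true _ = tt

-- The constant coefficient (no variables): 1 for the empty poset, else 0.
-- It depends only on |P|, so SameK needs no further work at m = 0.
isEmpty : ℕ → ℕ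
isEmpty zero    = 1
isEmpty (suc _) = 0

coeffK-no-variables : (S : RawPoset) → coeffK S [] ≡ isEmpty (size S)
coeffK-no-variables S = trans (coeffK-sumL S []) (count-maps (size S) _ every-map-is-partition)
  where
  count-maps : (n : ℕ) (h : (Fin n → Fin 0) → ℕ) → (n ≡ 0 → ∀ σ → h σ ≡ 1) → sumL h (allFuns n 0) ≡ isEmpty n
  count-maps zero    h h≡1 = trans (+-identityʳ _) (h≡1 refl _)
  count-maps (suc n) h h≡1 = trans (sumL-concatMap h _ (allFuns n 0)) (sumL-zero (allFuns n 0))
  every-map-is-partition : size S ≡ 0 → ∀ σ → ⟦ isPartition S [] σ ⟧ ≡ 1
  every-map-is-partition z σ = cong ⟦_⟧ (T→true (isPartition← S σ [] (λ x → ⊥-elim (no-element x)) (λ ())))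
    where
    no-element : Fin (size S) → ⊥
    no-element x with () ← subst Fin z x

sameK-no-variables : (S S' : RawPoset) → size S ≡ size S' → coeffK S [] ≡ coeffK S' []
sameK-no-variables S S' e =
  trans (coeffK-no-variables S) (trans (cong isEmpty e) (sym (coeffK-no-variables S')))

-- Two-block compositions count down-sets.  A subset s of Q becomes the
-- map sending s to the first value and its complement to the second.
twoBlock : {n : ℕ} → (Fin n → Bool) → Fin n → Fin 2
twoBlock s v = if s v then F.zero else F.suc F.zero

twoBlock-in : {n : ℕ} (s : Fin n → Bool) (v : Fin n) → T (s v) → twoBlock s v ≡ F.zero
twoBlock-in s v m rewrite T→true m = refl

twoBlock-out : {n : ℕ} (s : Fin n → Bool) (v : Fin n) → s v ≡ false → twoBlock s v ≡ F.suc F.zero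
twoBlock-out s v e rewrite e = refl

DownClosed : (Q : RawPoset) → (Fin (size Q) → Bool) → Set
DownClosed Q s = ∀ x y → T (le Q x y) → T (s y) → T (s x)

downSet-partition : (Q : RawPoset) (t : ℕ) (s : Fin (size Q) → Bool) → DownClosed Q s → count s ≡ t →
                    T (isPartition Q (t ∷ (size Q ∸ t) ∷ []) (twoBlock s))
downSet-partition Q t s down |s|≡t = isPartition← Q (twoBlock s) (t ∷ (size Q ∸ t) ∷ []) monotone content
  where
  monotone : OrderPreserving Q (twoBlock s)
  monotone x y l with s x in ex | s y in ey
  ... | true  | _     = z≤n
  ... | false | false = ≤-refl
  ... | false | true  = ⊥-elim (subst T ex (down x y l (true→T ey)))
  first : ∀ v → ⟦ twoBlock s v ≟Fᵇ F.zero ⟧ ≡ ⟦ s v ⟧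
  first v with s v
  ... | true  = refl
  ... | false = refl
  second : ∀ v → ⟦ twoBlock s v ≟Fᵇ F.suc F.zero ⟧ ≡ ⟦ not (s v) ⟧
  second v with s v
  ... | true  = refl
  ... | false = refl
  content : HasContent Q (t ∷ (size Q ∸ t) ∷ []) (twoBlock s)
  content F.zero          = trans (sumFin-cong first) |s|≡t
  content (F.suc F.zero)  = trans (sumFin-cong second)
    (trans (sym (m+n∸m≡n (count s) _)) (cong₂ _∸_ (count-complement s) |s|≡t))

-- In A ⊕ B the only down-set of size |A| is A itself:
-- coeffK (A ⊕ B) (|A| , |B|) = 1.  By peeling B off the top this is
-- coeffK A (|A| , 0), whose only partition is constant.
coeffK-⊕-cut : (A B : RawPoset) → coeffK (A ⊕ B) (size A ∷ size B ∷ []) ≡ 1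
coeffK-⊕-cut A B = trans (sym (peel-top A B (size A ∷ 0 ∷ [])))
  (coeffK-unique A α (twoBlock (λ _ → true)) all-first only-first)
  where
  a : ℕ
  a = size A
  α : Vec ℕ 2
  α = a ∷ 0 ∷ []
  all-first : T (isPartition A α (twoBlock (λ _ → true)))
  all-first = subst (λ z → T (isPartition A (a ∷ z ∷ []) (twoBlock (λ _ → true)))) (n∸n≡0 a)
    (downSet-partition A a (λ _ → true) (λ _ _ _ _ → tt) (trans (sumFin-const a 1) (*-identityʳ a)))
  only-first : ∀ σ → T (isPartition A α σ) → ∀ x → σ x ≡ F.zero
  only-first σ p x with σ x in e
  ... | F.zero = refl
  ... | F.suc F.zero with () ← trans (sym (≟Fᵇ-refl {2} (F.suc F.zero)))
          (trans (cong (_≟Fᵇ F.suc F.zero) (sym e))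
                 (count-empty⁻¹ (λ v → σ v ≟Fᵇ F.suc F.zero) (proj₂ (isPartition→ A σ α p) (F.suc F.zero)) x))

Cut : RawPoset → ℕ → Set
Cut Q t = ∀ x y → toℕ x < t → t ≤ toℕ y → T (le Q x y)

module Split (Q : RawPoset) (nl : IsNLPoset Q) (t : ℕ) (t≤q : t ≤ size Q) where
  private
    q : ℕ
    q = size Q
    t+[q∸t]≡q : t + (q ∸ t) ≡ q
    t+[q∸t]≡q = m+[n∸m]≡n t≤q

  from : Fin (t + (q ∸ t)) → Fin q
  from = cast t+[q∸t]≡q

  to : Fin q → Fin (t + (q ∸ t))
  to = cast (sym t+[q∸t]≡q)

  toℕ-from : ∀ u → toℕ (from u) ≡ toℕ u
  toℕ-from = toℕ-cast t+[q∸t]≡q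

  inL : Fin t → Fin q
  inL i = from (i ↑ˡ (q ∸ t))

  inR : Fin (q ∸ t) → Fin q
  inR j = from (t ↑ʳ j)

  toℕ-inL : ∀ i → toℕ (inL i) ≡ toℕ i
  toℕ-inL i = trans (toℕ-from _) (toℕ-↑ˡ i _)

  toℕ-inR : ∀ j → toℕ (inR j) ≡ t + toℕ j
  toℕ-inR j = trans (toℕ-from _) (toℕ-↑ʳ t j)

  lower : RawPoset
  lower = record { size = t ; le = λ i j → le Q (inL i) (inL j) }

  upper : RawPoset
  upper = record { size = q ∸ t ; le = λ i j → le Q (inR i) (inR j) }

  lower-NL : IsNLPoset lower
  lower-NL = record
    { refl≼    = λ x → refl≼ nl (inL x)
    ; antisym≼ = λ x y l₁ l₂ → toℕ-injective
                   (trans (sym (toℕ-inL x)) (trans (cong toℕ (antisym≼ nl _ _ l₁ l₂)) (toℕ-inL y)))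
    ; trans≼   = λ x y z → trans≼ nl (inL x) (inL y) (inL z)
    ; natural  = λ x y l → subst₂ _≤_ (toℕ-inL x) (toℕ-inL y) (natural nl _ _ l)
    }

  upper-NL : IsNLPoset upper
  upper-NL = record
    { refl≼    = λ x → refl≼ nl (inR x)
    ; antisym≼ = λ x y l₁ l₂ → toℕ-injective (+-cancelˡ-≡ t _ _
                   (trans (sym (toℕ-inR x)) (trans (cong toℕ (antisym≼ nl _ _ l₁ l₂)) (toℕ-inR y))))
    ; trans≼   = λ x y z → trans≼ nl (inR x) (inR y) (inR z)
    ; natural  = λ x y l → +-cancelˡ-≤ t _ _ (subst₂ _≤_ (toℕ-inR x) (toℕ-inR y) (natural nl _ _ l))
    }

  -- If t is a cut, the relabelling is an isomorphism Q ≅ lower ⊕ upper: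
  -- lower-to-upper pairs are related by the cut, upper-to-lower pairs
  -- never are, by the natural labeling.
  le-relabel : Cut Q t → ∀ u v → le Q (from u) (from v) ≡ le (lower ⊕ upper) u v
  le-relabel cut u v rewrite le⊕-splitAt lower upper u v with splitAt t u in e₁ | splitAt t v in e₂
  ... | inj₁ i | inj₁ j = cong₂ (le Q) (cong from (sym (splitAt⁻¹-↑ˡ e₁))) (cong from (sym (splitAt⁻¹-↑ˡ e₂)))
  ... | inj₂ i | inj₂ j = cong₂ (le Q) (cong from (sym (splitAt⁻¹-↑ʳ e₁))) (cong from (sym (splitAt⁻¹-↑ʳ e₂)))
  ... | inj₁ i | inj₂ j = T→true (cut (from u) (from v) u-low v-high)
    where
    u-low : toℕ (from u) < t
    u-low = subst (λ w → toℕ (from w) < t) (splitAt⁻¹-↑ˡ e₁) (subst (_< t) (sym (toℕ-inL i)) (toℕ<n i))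
    v-high : t ≤ toℕ (from v)
    v-high = subst (λ w → t ≤ toℕ (from w)) (splitAt⁻¹-↑ʳ e₂) (subst (t ≤_) (sym (toℕ-inR j)) (m≤m+n t _))
  ... | inj₂ i | inj₁ j = ¬T→false λ l → <⇒≱ (≤-trans v-low u-high) (natural nl _ _ l)
    where
    v-low : toℕ (from v) < t
    v-low = subst (λ w → toℕ (from w) < t) (splitAt⁻¹-↑ˡ e₂) (subst (_< t) (sym (toℕ-inL j)) (toℕ<n j))
    u-high : t ≤ toℕ (from u)
    u-high = subst (λ w → t ≤ toℕ (from w)) (splitAt⁻¹-↑ʳ e₁) (subst (t ≤_) (sym (toℕ-inR i)) (m≤m+n t _))

  cut-decomposition : Cut Q t → Q ≅ (lower ⊕ upper)
  cut-decomposition cut = record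
    { to      = to
    ; from    = from
    ; from∘to = from∘to
    ; to∘from = λ u → toℕ-injective (trans (toℕ-cast (sym t+[q∸t]≡q) _) (toℕ-from u))
    ; pres    = λ x y → trans (cong₂ (le Q) (sym (from∘to x)) (sym (from∘to y))) (le-relabel cut (to x) (to y))
    }
    where
    from∘to : ∀ x → from (to x) ≡ x
    from∘to x = toℕ-injective (trans (toℕ-from _) (toℕ-cast (sym t+[q∸t]≡q) x))

irreducible-no-cut : (Q : RawPoset) → IsNLPoset Q → Irreducible Q →
                     ∀ t → 0 < t → t < size Q → ¬ Cut Q t
irreducible-no-cut Q nl irr t 0<t t<q cut
  with irr lower upper lower-NL upper-NL (cut-decomposition cut)
  where open Split Q nl t (<⇒≤ t<q)
... | inj₁ |lower|≡0 = <⇒≢ 0<t (sym |lower|≡0)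
... | inj₂ |upper|≡0 = <⇒≢ (m<n⇒0<n∸m t<q) (sym |upper|≡0)

-- Extremal elements (by label) of a decidable predicate on Fin n, found by
-- repeatedly moving to a better witness; the fuel bounds the number of moves.
smallest : {n : ℕ} (D : Fin n → Set) → (∀ x → Dec (D x)) → ∀ x → D x →
           Σ (Fin n) λ w → D w × (∀ u → toℕ u < toℕ w → ¬ D u)
smallest {n} D D? x₀ d₀ = go (toℕ x₀) x₀ d₀ ≤-refl
  where
  go : ∀ fuel x → D x → toℕ x ≤ fuel → Σ (Fin n) λ w → D w × (∀ u → toℕ u < toℕ w → ¬ D u)
  go fuel x dx bound with any? (λ u → toℕ u <? toℕ x ×-dec D? u)
  ... | no none = x , dx , λ u lt du → none (u , lt , du)
  go zero       x dx bound | yes (u , lt , du) = ⊥-elim (<⇒≱ lt (≤-trans bound z≤n))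
  go (suc fuel) x dx bound | yes (u , lt , du) = go fuel u du (s≤s⁻¹ (≤-trans lt bound))

largest : {n : ℕ} (D : Fin n → Set) → (∀ x → Dec (D x)) → ∀ x → D x →
          Σ (Fin n) λ w → D w × (∀ u → toℕ w < toℕ u → ¬ D u)
largest {n} D D? x₀ d₀ = go (n ∸ toℕ x₀) x₀ d₀ ≤-refl
  where
  go : ∀ fuel x → D x → n ∸ toℕ x ≤ fuel → Σ (Fin n) λ w → D w × (∀ u → toℕ w < toℕ u → ¬ D u)
  go fuel x dx bound with any? (λ u → toℕ x <? toℕ u ×-dec D? u)
  ... | no none = x , dx , λ u lt du → none (u , lt , du)
  go zero       x dx bound | yes (u , lt , du) =
    ⊥-elim (<⇒≱ (∸-monoʳ-< lt (<⇒≤ (toℕ<n u))) (≤-trans bound z≤n))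
  go (suc fuel) x dx bound | yes (u , lt , du) =
    go fuel u du (s≤s⁻¹ (≤-trans (∸-monoʳ-< lt (<⇒≤ (toℕ<n u))) bound))

module _ (Q : RawPoset) (t : ℕ) where

  EarlyNotBelow : Fin (size Q) → Fin (size Q) → Set
  EarlyNotBelow y x = toℕ x < t × le Q x y ≡ false

  Obstruction : Fin (size Q) → Set
  Obstruction y = t ≤ toℕ y × Σ (Fin (size Q)) (EarlyNotBelow y)

  earlyNotBelow? : ∀ y x → Dec (EarlyNotBelow y x)
  earlyNotBelow? y x = (toℕ x <? t) ×-dec (le Q x y Bool.≟ false)

  obstruction? : ∀ y → Dec (Obstruction y)
  obstruction? y = (t ≤? toℕ y) ×-dec any? (earlyNotBelow? y)

  no-cut-obstruction : ¬ Cut Q t → Σ (Fin (size Q)) Obstruction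
  no-cut-obstruction no-cut with any? (λ y → obstruction? y)
  ... | yes found = found
  ... | no none = ⊥-elim (no-cut λ x y x<t t≤y → not-false (λ e → none (y , t≤y , x , x<t , e)))
    where
    not-false : ∀ {b} → ¬ b ≡ false → T b
    not-false {true}  _ = tt
    not-false {false} f = f refl

-- The exchange.  Let z be a label-minimal obstruction and w a label-maximal
-- early element not below z.  Then both {labels < t} and
-- {labels < t} - {w} ∪ {z} are down-sets with t elements.
module Exchange (Q : RawPoset) (nl : IsNLPoset Q) (t : ℕ) (t≤q : t ≤ size Q) (z w : Fin (size Q))
  (t≤z : t ≤ toℕ z) (w-early : EarlyNotBelow Q t z w)
  (z-minimal : ∀ u → toℕ u < toℕ z → ¬ Obstruction Q t u)
  (w-maximal : ∀ u → toℕ w < toℕ u → ¬ EarlyNotBelow Q t z u) where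
  private
    q : ℕ
    q = size Q
    α : Vec ℕ 2
    α = t ∷ (q ∸ t) ∷ []
    w<t : toℕ w < t
    w<t = proj₁ w-early
    w⋠z : le Q w z ≡ false
    w⋠z = proj₂ w-early

  w≢z : ¬ w ≡ z
  w≢z e = <⇒≱ w<t (subst (λ u → t ≤ toℕ u) (sym e) t≤z)

  below-is-smaller : ∀ x y → T (le Q x y) → ¬ x ≡ y → toℕ x < toℕ y
  below-is-smaller x y l ne = ≤∧≢⇒< (natural nl x y l) (ne ∘ toℕ-injective)

  early : Fin q → Bool
  early v = toℕ v <ᵇ t

  exchanged : Fin q → Bool
  exchanged v = (early v ∧ not (v ≟Fᵇ w)) ∨ (v ≟Fᵇ z)

  exchanged→ : ∀ v → T (exchanged v) → (toℕ v < t × ¬ v ≡ w) ⊎ v ≡ z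
  exchanged→ v m with Equivalence.to Bool.T-∨ m
  ... | inj₂ v=z = inj₂ (≟Fᵇ→ {i = v} {z} v=z)
  ... | inj₁ m' with Equivalence.to Bool.T-∧ m'
  ...   | v<t , v≠w = inj₁ (<ᵇ⇒< _ _ v<t , λ e → subst T (Equivalence.to Bool.T-not-≡ v≠w) (≟Fᵇ← {i = v} e))

  exchanged← : ∀ v → (toℕ v < t × ¬ v ≡ w) ⊎ v ≡ z → T (exchanged v)
  exchanged← v (inj₂ e) = Equivalence.from Bool.T-∨ (inj₂ (≟Fᵇ← {i = v} e))
  exchanged← v (inj₁ (v<t , v≢w)) = Equivalence.from Bool.T-∨ (inj₁ (Equivalence.from Bool.T-∧
    (<⇒<ᵇ v<t , Equivalence.from Bool.T-not-≡ (≟Fᵇ-≢ v≢w))))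

  early-down : DownClosed Q early
  early-down x y l y<t = <⇒<ᵇ (≤-<-trans (natural nl x y l) (<ᵇ⇒< (toℕ y) t y<t))

  -- Below z lie only early elements (minimality of z), never w (w ⋠ z);
  -- below an early y ≠ w there is no w (maximality of w).
  exchanged-down : DownClosed Q exchanged
  exchanged-down x y l m with exchanged→ y m
  ... | inj₂ refl with x F.≟ z
  ...   | yes x=z = exchanged← x (inj₂ x=z)
  ...   | no x≢z  = exchanged← x (inj₁ (x<t , x≢w))
    where
    x≢w : ¬ x ≡ w
    x≢w refl = subst T w⋠z l
    x<t : toℕ x < t
    x<t with toℕ x <? t
    ... | yes x<t = x<t
    ... | no x≮t = ⊥-elim (z-minimal x (below-is-smaller x z l x≢z)
                    (≮⇒≥ x≮t , w , w<t , ¬T→false (λ w≤x → subst T w⋠z (trans≼ nl w x z w≤x l))))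
  exchanged-down x y l m | inj₁ (y<t , y≢w) = exchanged← x (inj₁ (≤-<-trans (natural nl x y l) y<t , x≢w))
    where
    x≢w : ¬ x ≡ w
    x≢w refl = w-maximal y (below-is-smaller w y l (y≢w ∘ sym))
                 (y<t , ¬T→false (λ y≤z → subst T w⋠z (trans≼ nl w y z l y≤z)))

  -- Removing w and adding z keeps the size: pointwise,
  -- [v ∈ exchanged] + [v = w] = [v ∈ early] + [v = z].
  exchanged-count : count exchanged ≡ t
  exchanged-count = +-cancelʳ-≡ 1 _ _ (begin
    count exchanged + 1                                  ≡⟨ cong (count exchanged +_) (sym (count-point w)) ⟩
    count exchanged + count (_≟Fᵇ w)                     ≡⟨ sym (sumFin-+ (⟦_⟧ ∘ exchanged) _) ⟩
    sumFin (λ v → ⟦ exchanged v ⟧ + ⟦ v ≟Fᵇ w ⟧)         ≡⟨ sumFin-cong swap ⟩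
    sumFin (λ v → ⟦ early v ⟧ + ⟦ v ≟Fᵇ z ⟧)             ≡⟨ sumFin-+ (⟦_⟧ ∘ early) _ ⟩
    count early + count (_≟Fᵇ z)                         ≡⟨ cong₂ _+_ (count-initial q t t≤q) (count-point z) ⟩
    t + 1                                                ∎)
    where
    open ≡-Reasoning
    swap : ∀ v → ⟦ exchanged v ⟧ + ⟦ v ≟Fᵇ w ⟧ ≡ ⟦ early v ⟧ + ⟦ v ≟Fᵇ z ⟧
    swap v with v F.≟ w | v F.≟ z
    ... | yes refl | yes v=z = ⊥-elim (w≢z v=z)
    ... | yes refl | no v≢z rewrite ≟Fᵇ-refl w | ≟Fᵇ-≢ v≢z | T→true (<⇒<ᵇ w<t) = refl
    ... | no v≢w | yes refl rewrite ≟Fᵇ-refl z | ≟Fᵇ-≢ v≢w | ¬T→false (λ z<t → <⇒≱ (<ᵇ⇒< (toℕ z) t z<t) t≤z) = refl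
    ... | no v≢w | no v≢z rewrite ≟Fᵇ-≢ v≢w | ≟Fᵇ-≢ v≢z with early v
    ...   | true  = refl
    ...   | false = refl

  -- The two down-sets differ at w, so they are two distinct partitions.
  two-down-sets : 2 ≤ coeffK Q α
  two-down-sets = subst (2 ≤_) (sym (coeffK-sumL Q α))
    (Enumeration.two-solutions (funEnumeration q 2) (isPartition Q α) (isPartition-resp Q α)
      (twoBlock early) (twoBlock exchanged)
      (downSet-partition Q t early early-down (count-initial q t t≤q))
      (downSet-partition Q t exchanged exchanged-down exchanged-count)
      differ-at-w)
    where
    w-removed : exchanged w ≡ false
    w-removed = ¬T→false λ m → [ (λ (_ , w≢w) → w≢w refl) , w≢z ]′ (exchanged→ w m)
    differ-at-w : ¬ T (eqFunᵇ (twoBlock early) (twoBlock exchanged))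
    differ-at-w e with () ← trans (sym (twoBlock-in early w (<⇒<ᵇ w<t)))
                               (trans (eqFunᵇ→ e w) (twoBlock-out exchanged w w-removed))

no-cut-two-down-sets : (Q : RawPoset) → IsNLPoset Q → ∀ t → t ≤ size Q → ¬ Cut Q t →
                       2 ≤ coeffK Q (t ∷ (size Q ∸ t) ∷ [])
no-cut-two-down-sets Q nl t t≤q no-cut
  with no-cut-obstruction Q t no-cut
... | y₀ , obstruction₀
  with smallest (Obstruction Q t) (obstruction? Q t) y₀ obstruction₀
... | z , (t≤z , x₀ , x₀-early) , z-minimal
  with largest (EarlyNotBelow Q t z) (earlyNotBelow? Q t z) x₀ x₀-early
... | w , w-early , w-maximal = Exchange.two-down-sets Q nl t t≤q z w t≤z w-early z-minimal w-maximal

Summand : RawPoset → Set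
Summand S = IsNLPoset S × 1 ≤ size S × Irreducible S

summands : {Ps : List RawPoset} → All IsNLPoset Ps → All (λ S → 1 ≤ size S) Ps → All Irreducible Ps →
           All Summand Ps
summands []           []             []             = []
summands (nl ∷ nls)   (ne ∷ nes)     (irr ∷ irrs)   = (nl , ne , irr) ∷ summands nls nes irrs

sameK-sym : (S S' : RawPoset) → SameK S S' → SameK S' S
sameK-sym S S' sk m α = sym (sk m α)

-- A first summand cannot be strictly smaller than an irreducible one: with
-- t = |P|, peeling and cut counting give
--   coeffK Q (t , |Q| - t) = coeffK (Q ⊕ R') (t , |Q| - t + |R'|) = coeffK (P ⊕ R) (t , |R|) = 1,
-- while Q has no cut at t, so that coefficient is at least 2.
smaller-first-summand : (P R Q R' : RawPoset) → IsNLPoset Q → Irreducible Q →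
                        0 < size P → size P < size Q → SameK (P ⊕ R) (Q ⊕ R') → ⊥
smaller-first-summand P R Q R' nlQ irrQ 0<p p<q sk =
  <⇒≱ (s≤s (s≤s z≤n)) (subst (2 ≤_) coefficient-one
    (no-cut-two-down-sets Q nlQ p (<⇒≤ p<q) (irreducible-no-cut Q nlQ irrQ p 0<p p<q)))
  where
  p q : ℕ
  p = size P
  q = size Q
  rest : (q ∸ p) + size R' ≡ size R
  rest = begin
    (q ∸ p) + size R'    ≡⟨ sym (+-∸-comm (size R') (<⇒≤ p<q)) ⟩
    (q + size R') ∸ p    ≡⟨ cong (_∸ p) (sym (sameK-size (P ⊕ R) (Q ⊕ R') sk)) ⟩
    (p + size R) ∸ p     ≡⟨ m+n∸m≡n p (size R) ⟩
    size R               ∎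
    where open ≡-Reasoning
  coefficient-one : coeffK Q (p ∷ (q ∸ p) ∷ []) ≡ 1
  coefficient-one = begin
    coeffK Q (p ∷ (q ∸ p) ∷ [])                      ≡⟨ peel-top Q R' (p ∷ (q ∸ p) ∷ []) ⟩
    coeffK (Q ⊕ R') (p ∷ (q ∸ p) + size R' ∷ [])     ≡⟨ cong (λ k → coeffK (Q ⊕ R') (p ∷ k ∷ [])) rest ⟩
    coeffK (Q ⊕ R') (p ∷ size R ∷ [])                ≡⟨ sym (sk 2 (p ∷ size R ∷ [])) ⟩
    coeffK (P ⊕ R) (p ∷ size R ∷ [])                 ≡⟨ coeffK-⊕-cut P R ⟩
    1                                                ∎
    where open ≡-Reasoning

first-summand-size : (P R Q R' : RawPoset) → Summand P → Summand Q →
                     SameK (P ⊕ R) (Q ⊕ R') → size P ≡ size Q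
first-summand-size P R Q R' (nlP , neP , irrP) (nlQ , neQ , irrQ) sk with <-cmp (size P) (size Q)
... | tri< p<q _ _ = ⊥-elim (smaller-first-summand P R Q R' nlQ irrQ neP p<q sk)
... | tri≈ _ p≡q _ = p≡q
... | tri> _ _ q<p = ⊥-elim (smaller-first-summand Q R' P R nlP irrP neQ q<p (sameK-sym (P ⊕ R) (Q ⊕ R') sk))

-- With equal first sizes both parts are recovered: K_P by peeling R off
-- the top (pad the last entry by |R|), K_R by peeling P off the bottom
-- (pad the first entry by |P|); the sizes |R| = |R'| follow from sameK-size.
⊕-cancel : (P R Q R' : RawPoset) → size P ≡ size Q → SameK (P ⊕ R) (Q ⊕ R') → SameK P Q × SameK R R'
⊕-cancel P R Q R' p≡q sk = same-bottom , same-top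
  where
  r≡r' : size R ≡ size R'
  r≡r' = +-cancelˡ-≡ (size P) _ _
           (trans (sameK-size (P ⊕ R) (Q ⊕ R') sk) (cong (_+ size R') (sym p≡q)))
  same-bottom : SameK P Q
  same-bottom zero    [] = sameK-no-variables P Q p≡q
  same-bottom (suc m) β  = begin
    coeffK P β                                         ≡⟨ peel-top P R β ⟩
    coeffK (P ⊕ R) (addAt β (fromℕ m) (size R))        ≡⟨ sk (suc m) (addAt β (fromℕ m) (size R)) ⟩
    coeffK (Q ⊕ R') (addAt β (fromℕ m) (size R))       ≡⟨ cong (coeffK (Q ⊕ R') ∘ addAt β (fromℕ m)) r≡r' ⟩
    coeffK (Q ⊕ R') (addAt β (fromℕ m) (size R'))      ≡⟨ sym (peel-top Q R' β) ⟩
    coeffK Q β                                         ∎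
    where open ≡-Reasoning
  same-top : SameK R R'
  same-top zero    [] = sameK-no-variables R R' r≡r'
  same-top (suc m) γ  = begin
    coeffK R γ                                         ≡⟨ peel-bottom P R γ ⟩
    coeffK (P ⊕ R) (addAt γ F.zero (size P))           ≡⟨ sk (suc m) (addAt γ F.zero (size P)) ⟩
    coeffK (Q ⊕ R') (addAt γ F.zero (size P))          ≡⟨ cong (coeffK (Q ⊕ R') ∘ addAt γ F.zero) p≡q ⟩
    coeffK (Q ⊕ R') (addAt γ F.zero (size Q))          ≡⟨ sym (peel-bottom Q R' γ) ⟩
    coeffK R' γ                                        ∎
    where open ≡-Reasoning

sameK-⨁ : (Ps Qs : List RawPoset) → All Summand Ps → All Summand Qs →
          SameK (⨁ Ps) (⨁ Qs) → length Ps ≡ length Qs × Pointwise SameK Ps Qs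
sameK-⨁ []       []       _ _ _  = refl , []
sameK-⨁ []       (Q ∷ Qs) _ ((_ , neQ , _) ∷ _) sk =
  ⊥-elim (<⇒≢ (≤-trans neQ (m≤m+n (size Q) _)) (sameK-size ∅P (Q ⊕ ⨁ Qs) sk))
sameK-⨁ (P ∷ Ps) []       ((_ , neP , _) ∷ _) _ sk =
  ⊥-elim (<⇒≢ (≤-trans neP (m≤m+n (size P) _)) (sameK-size ∅P (P ⊕ ⨁ Ps) (sameK-sym (P ⊕ ⨁ Ps) ∅P sk)))
sameK-⨁ (P ∷ Ps) (Q ∷ Qs) (sP ∷ sPs) (sQ ∷ sQs) sk
  with ⊕-cancel P (⨁ Ps) Q (⨁ Qs) (first-summand-size P (⨁ Ps) Q (⨁ Qs) sP sQ sk) sk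
... | same-first , same-rest with sameK-⨁ Ps Qs sPs sQs same-rest
...   | same-length , same-summands = cong suc same-length , same-first ∷ same-summands

lemma2p7 : (P Q : RawPoset) → IsNLPoset P → IsNLPoset Q →
           (Ps Qs : List RawPoset) → IrredDecomp P Ps → IrredDecomp Q Qs →
           SameK P Q →
           length Ps ≡ length Qs × Pointwise SameK Ps Qs
lemma2p7 P Q _ _ Ps Qs (nlPs , nePs , irrPs , P≅⨁Ps) (nlQs , neQs , irrQs , Q≅⨁Qs) sk =
  sameK-⨁ Ps Qs (summands nlPs nePs irrPs) (summands nlQs neQs irrQs) same-sums
  where
  same-sums : SameK (⨁ Ps) (⨁ Qs)
  same-sums m α = begin
    coeffK (⨁ Ps) α   ≡⟨ sym (coeffK-iso P (⨁ Ps) P≅⨁Ps α) ⟩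
    coeffK P α        ≡⟨ sk m α ⟩
    coeffK Q α        ≡⟨ coeffK-iso Q (⨁ Qs) Q≅⨁Qs α ⟩
    coeffK (⨁ Qs) α   ∎
    where open ≡-Reasoning
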